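{- Let $H=(V,E)$ and $H'=(V',E')$ be $d$-uniform hypergraphs with $d\ge 3$ such that $\mathrm{Z}_0(H)\,\mathrm{Z}_0(H')\le 3$. Then $\mathrm{Z}_0(H\,\Box\, H')=\mathrm{Z}_0(H)\,\mathrm{Z}_0(H')$.
   Context: For a set $S$ and an object $v$, $S\times v=\{(x,v):x\in S\}$ and $v\times S=\{(v,x):x\in S\}$. The Cartesian product $H\Box H'$ is the $d$-hypergraph with vertex set $V\times V'$ and edge set $\{e\times v': e\in E, v'\in V'\}\cup\{v\times e': v\in V, e'\in E'\}$. $\mathrm{Z}_0$ of a $d$-hypergraph: with a set $B$ initially blue and the others white, a set $S$ of $d-1$ distinct vertices (not necessarily blue) can turn a white vertex $w$ blue if $S\cup\{w\}$ is an edge and every white $u$ such that $S\cup\{u\}$ is an edge equals $w$. $B$ is a zero forcing set if repeated application colors all vertices blue; $\mathrm{Z}_0$ is the minimum cardinality of a zero forcing set. -}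

module Defs where

open import Data.Nat using (ℕ; suc; _+_; _*_; _≤_)
open import Data.Bool using (Bool; _∧_)
open import Data.Fin using (Fin; remQuot)
open import Data.Fin.Properties using (_≟_)
open import Data.Fin.Subset using (Subset; _∪_; ⁅_⁆; ⊤; _∈_; _∉_; ∣_∣)
open import Data.List using (List; map; concatMap; allFin; _++_)
open import Data.List.Relation.Unary.All using (All)
import Data.List.Membership.Propositional as LM
open import Data.Vec using (lookup; tabulate)
open import Data.Product using (Σ; _×_; _,_; proj₁; proj₂)
open import Relation.Nullary.Decidable using (⌊_⌋)
open import Relation.Binary.PropositionalEquality using (_≡_)
open import Relation.Binary.Construct.Closure.ReflexiveTransitive using (Star)

record Hypergraph : Set where
  constructor hypergraph
  field
    n     : ℕ
    edges : List (Subset n)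
open Hypergraph public

IsEdge : (H : Hypergraph) → Subset (n H) → Set
IsEdge H e = e LM.∈ edges H

Uniform : ℕ → Hypergraph → Set
Uniform d H = All (λ e → ∣ e ∣ ≡ d) (edges H)

-- Cartesian product; the vertex (x , y) ∈ V × V' is encoded as combine x y : Fin (n * n').
-- e × v'  = { (x , v') : x ∈ e }
liftL : ∀ {n n'} → Subset n → Fin n' → Subset (n * n')
liftL {n} {n'} e v' = tabulate λ i →
  lookup e (proj₁ (remQuot {n} n' i)) ∧ ⌊ proj₂ (remQuot {n} n' i) ≟ v' ⌋

liftR : ∀ {n n'} → Fin n → Subset n' → Subset (n * n')
liftR {n} {n'} v e' = tabulate λ i →
  ⌊ proj₁ (remQuot {n} n' i) ≟ v ⌋ ∧ lookup e' (proj₂ (remQuot {n} n' i))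

_□_ : Hypergraph → Hypergraph → Hypergraph
H □ H' = hypergraph (n H * n H')
  ( concatMap (λ e → map (λ v' → liftL {n H} {n H'} e v') (allFin (n H'))) (edges H)
  ++ concatMap (λ e' → map (λ v → liftR {n H} {n H'} v e') (allFin (n H))) (edges H') )

data ForceStep (d : ℕ) (H : Hypergraph) : Subset (n H) → Subset (n H) → Set where
  force : ∀ {B : Subset (n H)} (S : Subset (n H)) (w : Fin (n H)) →
          ∣ S ∣ + 1 ≡ d →
          w ∉ B →
          IsEdge H (S ∪ ⁅ w ⁆) →
          (∀ (u : Fin (n H)) → u ∉ B → IsEdge H (S ∪ ⁅ u ⁆) → u ≡ w) →
          ForceStep d H B (B ∪ ⁅ w ⁆)

ZeroForcingSet : (d : ℕ) (H : Hypergraph) → Subset (n H) → Set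
ZeroForcingSet d H B = Star (ForceStep d H) B ⊤

IsZ0 : (d : ℕ) (H : Hypergraph) → ℕ → Set
IsZ0 d H k =
  (Σ (Subset (n H)) λ B → ZeroForcingSet d H B × ∣ B ∣ ≡ k)
  × (∀ (B : Subset (n H)) → ZeroForcingSet d H B → k ≤ ∣ B ∣)

-- Upper bound: if B forces H and B′ forces H′, then B × B′ forces H □ H′. First each
-- column a × B′ (a ∈ B) forces the whole column a × V′, copying the forces of B′ in H′;
-- then each row B × b forces V × b. A copied force is never spoiled by an edge of the
-- other direction, because a column meets a row in one vertex while a forcing set has
-- d − 1 ≥ 2 vertices.
--
-- Lower bound: if ∅ does not force H, the projection to H′ of any zero forcing set X of
-- H □ H′ forces H′. Otherwise forcing stalls at a proper closed set C of H′ containing the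
-- projection, forcing from ∅ stalls at a proper closed set R of H, and the cylinder
-- (R × V′) ∪ (V × C) is a proper closed set of H □ H′ containing X. As Z₀(H) Z₀(H′) ≤ 3,
-- one factor is at most 1, and the two bounds meet.

module Submission where

open import Defs
open import Data.Nat using (ℕ; zero; suc; _+_; _*_; _≤_; _<_; z≤n; s≤s)
import Data.Nat.Properties as ℕ
open import Data.Fin using (Fin; zero; suc; combine; remQuot)
import Data.Fin.Properties as Fin
open import Data.Fin.Subset using (Subset; _∪_; ⁅_⁆; ⊤; ⊥; _∈_; _∉_; ∣_∣; _⊆_; inside; outside)
import Data.Fin.Subset.Properties as Sub
open import Data.Bool using (Bool; true; _∧_)
import Data.Bool.Properties as Bool
open import Data.List using (List; map; concatMap; allFin)
open import Data.List.Membership.Propositional using () renaming (_∈_ to _∈ₗ_)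
open import Data.List.Membership.Propositional.Properties
  using (∈-map⁺; ∈-map⁻; ∈-concat⁺′; ∈-concat⁻′; ∈-++⁺ˡ; ∈-++⁺ʳ; ∈-++⁻; ∈-allFin)
open import Data.Vec using (_∷_; []; here; there; lookup; tabulate)
import Data.Vec.Properties as Vec
import Data.List.Relation.Unary.All as All
import Data.List.Membership.DecPropositional as DecMembership
open import Data.Product using (Σ-syntax; _×_; _,_; proj₁; proj₂)
open import Data.Sum using (_⊎_; inj₁; inj₂)
import Data.Sum as Sum
open import Data.Empty using (⊥-elim)
open import Function using (_∘_; flip)
open import Function.Definitions using (Injective)
open import Relation.Nullary using (¬_; Dec; yes; no)
open import Relation.Nullary.Decidable
  using (⌊_⌋; ¬?; _×-dec_; _→-dec_; decidable-stable; toWitness; fromWitness)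
open import Function.Bundles using (module Equivalence)
open import Relation.Binary.PropositionalEquality
open import Relation.Binary.Construct.Closure.ReflexiveTransitive using (Star; ε; _◅_; kleisliStar)
open import Relation.Binary.Construct.Closure.ReflexiveTransitive.Properties using (module StarReasoning)
open import Algebra.Bundles using (CommutativeMonoid)
import Algebra.Properties.CommutativeSemigroup as CommutativeSemigroupProperties

private
  variable
    m k : ℕ

⋃[_]_ : Subset m → (Fin m → Subset k) → Subset k
⋃[ [] ] F = ⊥
⋃[ inside ∷ p ] F = F zero ∪ ⋃[ p ] (F ∘ suc)
⋃[ outside ∷ p ] F = ⋃[ p ] (F ∘ suc)

image : (Fin m → Fin k) → Subset m → Subset k
image f p = ⋃[ p ] (⁅_⁆ ∘ f)

preimage : (Fin m → Fin k) → Subset k → Subset m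
preimage f q = tabulate (lookup q ∘ f)

∈-⋃⁺ : (p : Subset m) (F : Fin m → Subset k) {a : Fin m} {x : Fin k} →
       a ∈ p → x ∈ F a → x ∈ ⋃[ p ] F
∈-⋃⁺ (inside ∷ p) F here x∈ = Sub.p⊆p∪q _ x∈
∈-⋃⁺ (inside ∷ p) F (there a∈) x∈ = Sub.q⊆p∪q (F zero) _ (∈-⋃⁺ p (F ∘ suc) a∈ x∈)
∈-⋃⁺ (outside ∷ p) F (there a∈) x∈ = ∈-⋃⁺ p (F ∘ suc) a∈ x∈

∈-⋃⁻ : (p : Subset m) (F : Fin m → Subset k) {x : Fin k} →
       x ∈ ⋃[ p ] F → Σ[ a ∈ Fin m ] a ∈ p × x ∈ F a
∈-⋃⁻ [] F x∈ = ⊥-elim (Sub.∉⊥ x∈)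
∈-⋃⁻ (inside ∷ p) F x∈ with Sub.x∈p∪q⁻ (F zero) _ x∈
... | inj₁ x∈F₀ = zero , here , x∈F₀
... | inj₂ x∈⋃ with ∈-⋃⁻ p (F ∘ suc) x∈⋃
...   | a , a∈ , x∈Fa = suc a , there a∈ , x∈Fa
∈-⋃⁻ (outside ∷ p) F x∈ with ∈-⋃⁻ p (F ∘ suc) x∈
... | a , a∈ , x∈Fa = suc a , there a∈ , x∈Fa

∈-image⁺ : (f : Fin m → Fin k) (p : Subset m) {a : Fin m} → a ∈ p → f a ∈ image f p
∈-image⁺ f p a∈ = ∈-⋃⁺ p _ a∈ (Sub.x∈⁅x⁆ _)

∈-image⁻ : (f : Fin m → Fin k) (p : Subset m) {x : Fin k} →
           x ∈ image f p → Σ[ a ∈ Fin m ] a ∈ p × f a ≡ x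
∈-image⁻ f p x∈ with ∈-⋃⁻ p _ x∈
... | a , a∈ , x∈⁅fa⁆ = a , a∈ , sym (Sub.x∈⁅y⁆⇒x≡y _ x∈⁅fa⁆)

∈-tabulate⁺ : {g : Fin m → _} {x : Fin m} → g x ≡ inside → x ∈ tabulate g
∈-tabulate⁺ {g = g} {x} gx = Vec.lookup⇒[]= x _ (trans (Vec.lookup∘tabulate g x) gx)

∈-tabulate⁻ : {g : Fin m → _} {x : Fin m} → x ∈ tabulate g → g x ≡ inside
∈-tabulate⁻ {g = g} {x} x∈ = trans (sym (Vec.lookup∘tabulate g x)) (Vec.[]=⇒lookup x∈)

∈-preimage⁺ : (f : Fin m → Fin k) (q : Subset k) {x : Fin m} → f x ∈ q → x ∈ preimage f q
∈-preimage⁺ f q fx∈ = ∈-tabulate⁺ (Vec.[]=⇒lookup fx∈)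

∈-preimage⁻ : (f : Fin m → Fin k) (q : Subset k) {x : Fin m} → x ∈ preimage f q → f x ∈ q
∈-preimage⁻ f q x∈ = Vec.lookup⇒[]= _ q (∈-tabulate⁻ x∈)

∪⁅⁆-absorb : (p : Subset m) {x : Fin m} → x ∈ p → p ∪ ⁅ x ⁆ ≡ p
∪⁅⁆-absorb p {x} x∈ = Sub.⊆-antisym ⊆p (Sub.p⊆p∪q _)
  where
  ⊆p : p ∪ ⁅ x ⁆ ⊆ p
  ⊆p y∈ with Sub.x∈p∪q⁻ p _ y∈
  ... | inj₁ y∈p = y∈p
  ... | inj₂ y∈⁅x⁆ = subst (_∈ p) (sym (Sub.x∈⁅y⁆⇒x≡y x y∈⁅x⁆)) x∈

∣p∪q∣≤∣p∣+∣q∣ : (p q : Subset m) → ∣ p ∪ q ∣ ≤ ∣ p ∣ + ∣ q ∣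
∣p∪q∣≤∣p∣+∣q∣ [] [] = z≤n
∣p∪q∣≤∣p∣+∣q∣ (inside ∷ p) (inside ∷ q) =
  s≤s (ℕ.≤-trans (∣p∪q∣≤∣p∣+∣q∣ p q) (ℕ.+-monoʳ-≤ ∣ p ∣ (ℕ.n≤1+n _)))
∣p∪q∣≤∣p∣+∣q∣ (inside ∷ p) (outside ∷ q) = s≤s (∣p∪q∣≤∣p∣+∣q∣ p q)
∣p∪q∣≤∣p∣+∣q∣ (outside ∷ p) (inside ∷ q) rewrite ℕ.+-suc ∣ p ∣ ∣ q ∣ = s≤s (∣p∪q∣≤∣p∣+∣q∣ p q)
∣p∪q∣≤∣p∣+∣q∣ (outside ∷ p) (outside ∷ q) = ∣p∪q∣≤∣p∣+∣q∣ p q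

∣p∪⁅x⁆∣≡1+∣p∣ : (p : Subset m) {x : Fin m} → x ∉ p → ∣ p ∪ ⁅ x ⁆ ∣ ≡ suc ∣ p ∣
∣p∪⁅x⁆∣≡1+∣p∣ (inside ∷ p) {zero} x∉ = ⊥-elim (x∉ here)
∣p∪⁅x⁆∣≡1+∣p∣ (outside ∷ p) {zero} x∉ = cong (suc ∘ ∣_∣) (Sub.∪-identityʳ p)
∣p∪⁅x⁆∣≡1+∣p∣ (inside ∷ p) {suc x} x∉ = cong suc (∣p∪⁅x⁆∣≡1+∣p∣ p (x∉ ∘ there))
∣p∪⁅x⁆∣≡1+∣p∣ (outside ∷ p) {suc x} x∉ = ∣p∪⁅x⁆∣≡1+∣p∣ p (x∉ ∘ there)

∣⋃∣≤ : (p : Subset m) (F : Fin m → Subset k) {c : ℕ} → (∀ a → ∣ F a ∣ ≤ c) → ∣ ⋃[ p ] F ∣ ≤ ∣ p ∣ * c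
∣⋃∣≤ {k = k} [] F _ = ℕ.≤-reflexive (Sub.∣⊥∣≡0 k)
∣⋃∣≤ (inside ∷ p) F ∣F∣≤c =
  ℕ.≤-trans (∣p∪q∣≤∣p∣+∣q∣ (F zero) _) (ℕ.+-mono-≤ (∣F∣≤c zero) (∣⋃∣≤ p (F ∘ suc) (∣F∣≤c ∘ suc)))
∣⋃∣≤ (outside ∷ p) F ∣F∣≤c = ∣⋃∣≤ p (F ∘ suc) (∣F∣≤c ∘ suc)

∣image∣≤∣p∣ : (f : Fin m → Fin k) (p : Subset m) → ∣ image f p ∣ ≤ ∣ p ∣
∣image∣≤∣p∣ f p = subst (∣ image f p ∣ ≤_) (ℕ.*-identityʳ ∣ p ∣)
  (∣⋃∣≤ p _ (λ a → ℕ.≤-reflexive (Sub.∣⁅x⁆∣≡1 (f a))))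

∣image∣≡∣p∣ : (f : Fin m → Fin k) → Injective _≡_ _≡_ f → (p : Subset m) → ∣ image f p ∣ ≡ ∣ p ∣
∣image∣≡∣p∣ {k = k} f f-inj [] = Sub.∣⊥∣≡0 k
∣image∣≡∣p∣ f f-inj (outside ∷ p) = ∣image∣≡∣p∣ (f ∘ suc) (Fin.suc-injective ∘ f-inj) p
∣image∣≡∣p∣ f f-inj (inside ∷ p) = begin
  ∣ ⁅ f zero ⁆ ∪ image (f ∘ suc) p ∣ ≡⟨ cong ∣_∣ (Sub.∪-comm ⁅ f zero ⁆ (image (f ∘ suc) p)) ⟩
  ∣ image (f ∘ suc) p ∪ ⁅ f zero ⁆ ∣ ≡⟨ ∣p∪⁅x⁆∣≡1+∣p∣ _ f₀∉ ⟩
  suc ∣ image (f ∘ suc) p ∣          ≡⟨ cong suc (∣image∣≡∣p∣ (f ∘ suc) (Fin.suc-injective ∘ f-inj) p) ⟩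
  suc ∣ p ∣                          ∎
  where
  open ≡-Reasoning
  f₀∉ : f zero ∉ image (f ∘ suc) p
  f₀∉ f₀∈ with ∈-image⁻ (f ∘ suc) p f₀∈
  ... | a , _ , fa≡f₀ with f-inj fa≡f₀
  ... | ()

image-injective : (f : Fin m → Fin k) → Injective _≡_ _≡_ f →
                  {p q : Subset m} → image f p ≡ image f q → p ≡ q
image-injective f f-inj eq = Sub.⊆-antisym (transfer eq) (transfer (sym eq))
  where
  transfer : ∀ {p q} → image f p ≡ image f q → p ⊆ q
  transfer {p} {q} eq x∈p with ∈-image⁻ f q (subst (f _ ∈_) eq (∈-image⁺ f p x∈p))
  ... | a , a∈q , fa≡fx = subst (_∈ q) (f-inj fa≡fx) a∈q

image-∪⁅⁆ : (f : Fin m → Fin k) (p : Subset m) (a : Fin m) →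
            image f (p ∪ ⁅ a ⁆) ≡ image f p ∪ ⁅ f a ⁆
image-∪⁅⁆ f p a = Sub.⊆-antisym ⊆ʳ ⊆ˡ
  where
  ⊆ʳ : image f (p ∪ ⁅ a ⁆) ⊆ image f p ∪ ⁅ f a ⁆
  ⊆ʳ x∈ with ∈-image⁻ f _ x∈
  ... | b , b∈ , refl with Sub.x∈p∪q⁻ p _ b∈
  ...   | inj₁ b∈p = Sub.p⊆p∪q _ (∈-image⁺ f p b∈p)
  ...   | inj₂ b∈⁅a⁆ = subst (λ c → f c ∈ image f p ∪ ⁅ f a ⁆) (sym (Sub.x∈⁅y⁆⇒x≡y a b∈⁅a⁆))
                         (Sub.q⊆p∪q (image f p) _ (Sub.x∈⁅x⁆ _))
  ⊆ˡ : image f p ∪ ⁅ f a ⁆ ⊆ image f (p ∪ ⁅ a ⁆)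
  ⊆ˡ x∈ with Sub.x∈p∪q⁻ (image f p) _ x∈
  ... | inj₂ x∈⁅fa⁆ = subst (_∈ image f (p ∪ ⁅ a ⁆)) (sym (Sub.x∈⁅y⁆⇒x≡y _ x∈⁅fa⁆))
                         (∈-image⁺ f _ (Sub.q⊆p∪q p _ (Sub.x∈⁅x⁆ a)))
  ... | inj₁ x∈img with ∈-image⁻ f p x∈img
  ...   | b , b∈ , refl = ∈-image⁺ f _ (Sub.p⊆p∪q _ b∈)

∣p∣≥1⇒nonempty : (p : Subset m) → 1 ≤ ∣ p ∣ → Σ[ x ∈ Fin m ] x ∈ p
∣p∣≥1⇒nonempty (inside ∷ p) _ = zero , here
∣p∣≥1⇒nonempty (outside ∷ p) ∣p∣≥1 with ∣p∣≥1⇒nonempty p ∣p∣≥1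
... | x , x∈ = suc x , there x∈

Star-⋃ : {N : ℕ} {R : Subset N → Subset N → Set} {F F′ : Fin m → Subset N} →
         (∀ a Y → Star R (Y ∪ F a) (Y ∪ F′ a)) →
         ∀ p Y → Star R (Y ∪ ⋃[ p ] F) (Y ∪ ⋃[ p ] F′)
Star-⋃ steps [] Y = ε
Star-⋃ steps (outside ∷ p) Y = Star-⋃ (steps ∘ suc) p Y
Star-⋃ {N = N} {R} {F} {F′} steps (inside ∷ p) Y = begin
  Y ∪ (F zero ∪ ⋃F)        ≡⟨ x∙yz≈xz∙y Y (F zero) ⋃F ⟩
  (Y ∪ ⋃F) ∪ F zero        ⟶*⟨ steps zero (Y ∪ ⋃F) ⟩
  (Y ∪ ⋃F) ∪ F′ zero       ≡⟨ x∙yz≈xz∙y Y (F′ zero) ⋃F ⟨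
  Y ∪ (F′ zero ∪ ⋃F)       ≡⟨ Sub.∪-assoc Y (F′ zero) ⋃F ⟨
  (Y ∪ F′ zero) ∪ ⋃F       ⟶*⟨ Star-⋃ (steps ∘ suc) p (Y ∪ F′ zero) ⟩
  (Y ∪ F′ zero) ∪ ⋃F′      ≡⟨ Sub.∪-assoc Y (F′ zero) ⋃F′ ⟩
  Y ∪ (F′ zero ∪ ⋃F′)      ∎
  where
  open StarReasoning R
  open CommutativeSemigroupProperties
    (CommutativeMonoid.commutativeSemigroup (Sub.∪-commutativeMonoid N)) using (x∙yz≈xz∙y)
  ⋃F ⋃F′ : Subset N
  ⋃F  = ⋃[ p ] (F ∘ suc)
  ⋃F′ = ⋃[ p ] (F′ ∘ suc)

-- The condition ∣ S ∣ + 1 ≡ d of ForceStep is dropped: in a d-uniform hypergraph it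
-- follows from w ∉ S (see Forces⇒ForceStep).
Forces : (G : Hypergraph) → Subset (n G) → Subset (n G) → Fin (n G) → Set
Forces G C S w = w ∉ S × w ∉ C × IsEdge G (S ∪ ⁅ w ⁆) ×
  (∀ u → u ∉ C → IsEdge G (S ∪ ⁅ u ⁆) → u ≡ w)

Closed : (G : Hypergraph) → Subset (n G) → Set
Closed G C = ∀ S w → ¬ Forces G C S w

Stalls : (G : Hypergraph) → Subset (n G) → Set
Stalls G B = Σ[ C ∈ Subset (n G) ] B ⊆ C × Closed G C × Σ[ x ∈ Fin (n G) ] x ∉ C

isEdge? : (G : Hypergraph) (E : Subset (n G)) → Dec (IsEdge G E)
isEdge? G E = DecMembership._∈?_ (Vec.≡-dec Bool._≟_) E (edges G)

forces? : (G : Hypergraph) (C S : Subset (n G)) (w : Fin (n G)) → Dec (Forces G C S w)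
forces? G C S w = ¬? (w Sub.∈? S) ×-dec ¬? (w Sub.∈? C) ×-dec isEdge? G _ ×-dec
  Fin.all? (λ u → ¬? (u Sub.∈? C) →-dec isEdge? G _ →-dec u Fin.≟ w)

module _ {d : ℕ} {G : Hypergraph} (G-uniform : Uniform d G) where

  ∣edge∣≡d : ∀ {E} → IsEdge G E → ∣ E ∣ ≡ d
  ∣edge∣≡d = All.lookup G-uniform

  ∣S∣+1≡d⇒w∉S : ∀ {S w} → ∣ S ∣ + 1 ≡ d → IsEdge G (S ∪ ⁅ w ⁆) → w ∉ S
  ∣S∣+1≡d⇒w∉S {S} {w} ∣S∣+1≡d edge w∈S = ℕ.m+1+n≢m ∣ S ∣ {0} (begin
    ∣ S ∣ + 1        ≡⟨ ∣S∣+1≡d ⟩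
    d                ≡⟨ ∣edge∣≡d edge ⟨
    ∣ S ∪ ⁅ w ⁆ ∣    ≡⟨ cong ∣_∣ (∪⁅⁆-absorb S w∈S) ⟩
    ∣ S ∣            ∎)
    where open ≡-Reasoning

  Forces⇒ForceStep : ∀ {B S w} → Forces G B S w → ForceStep d G B (B ∪ ⁅ w ⁆)
  Forces⇒ForceStep {B} {S} {w} (w∉S , w∉B , edge , unique) = force S w ∣S∣+1≡d w∉B edge unique
    where
    ∣S∣+1≡d : ∣ S ∣ + 1 ≡ d
    ∣S∣+1≡d = trans (ℕ.+-comm ∣ S ∣ 1) (trans (sym (∣p∪⁅x⁆∣≡1+∣p∣ S w∉S)) (∣edge∣≡d edge))

  -- A vertex forced from B ⊆ C but lying outside C would also be forced with C blue,
  -- since the vertices outside C are among those outside B.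
  closed-confines : ∀ {B C D} → Closed G C → B ⊆ C → Star (ForceStep d G) B D → D ⊆ C
  closed-confines closed B⊆C ε = B⊆C
  closed-confines {B} {C} closed B⊆C (force S w ∣S∣+1≡d w∉B edge unique ◅ steps) =
    closed-confines closed B∪w⊆C steps
    where
    w∈C : w ∈ C
    w∈C = decidable-stable (w Sub.∈? C) λ w∉C →
      closed S w (∣S∣+1≡d⇒w∉S ∣S∣+1≡d edge , w∉C , edge , λ u u∉C → unique u (u∉C ∘ B⊆C))
    B∪w⊆C : B ∪ ⁅ w ⁆ ⊆ C
    B∪w⊆C x∈ with Sub.x∈p∪q⁻ B _ x∈
    ... | inj₁ x∈B = B⊆C x∈B
    ... | inj₂ x∈⁅w⁆ = subst (_∈ C) (sym (Sub.x∈⁅y⁆⇒x≡y w x∈⁅w⁆)) w∈C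

  zeroForcing⊎stalls′ : (fuel : ℕ) (B : Subset (n G)) → n G ≤ fuel + ∣ B ∣ →
                        ZeroForcingSet d G B ⊎ Stalls G B
  zeroForcing⊎stalls′ fuel B n≤fuel+∣B∣ with Sub.anySubset? (λ S → Fin.any? (forces? G B S))
  ... | yes (S , w , forces@(_ , w∉B , _)) with fuel
  ...   | zero = ⊥-elim (ℕ.<⇒≱ ∣B∣<n n≤fuel+∣B∣)
    where
    ∣B∣<n : ∣ B ∣ < n G
    ∣B∣<n = ℕ.≤-trans (ℕ.≤-reflexive (sym (∣p∪⁅x⁆∣≡1+∣p∣ B w∉B))) (Sub.∣p∣≤n (B ∪ ⁅ w ⁆))
  ...   | suc fuel′ with zeroForcing⊎stalls′ fuel′ (B ∪ ⁅ w ⁆) bound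
    where
    bound : n G ≤ fuel′ + ∣ B ∪ ⁅ w ⁆ ∣
    bound = subst (n G ≤_)
      (trans (sym (ℕ.+-suc fuel′ ∣ B ∣)) (cong (fuel′ +_) (sym (∣p∪⁅x⁆∣≡1+∣p∣ B w∉B))))
      n≤fuel+∣B∣
  ...     | inj₁ zeroForcing = inj₁ (Forces⇒ForceStep forces ◅ zeroForcing)
  ...     | inj₂ (C , B∪w⊆C , closed , x , x∉C) =
    inj₂ (C , B∪w⊆C ∘ Sub.p⊆p∪q _ , closed , x , x∉C)
  zeroForcing⊎stalls′ fuel B _ | no noForce with Fin.any? (λ x → ¬? (x Sub.∈? B))
  ... | yes (x , x∉B) = inj₂ (B , (λ x∈ → x∈) , (λ S w forces → noForce (S , w , forces)) , x , x∉B)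
  ... | no allBlue = inj₁ (subst (Star (ForceStep d G) B) B≡⊤ ε)
    where
    B≡⊤ : B ≡ ⊤
    B≡⊤ = Sub.⊆-antisym Sub.⊆⊤ (λ {x} _ → decidable-stable (x Sub.∈? B) (λ x∉B → allBlue (x , x∉B)))

  zeroForcing⊎stalls : (B : Subset (n G)) → ZeroForcingSet d G B ⊎ Stalls G B
  zeroForcing⊎stalls B = zeroForcing⊎stalls′ (n G) B (ℕ.m≤m+n (n G) ∣ B ∣)

forces-pullback : ∀ {G P : Hypergraph} {φ : Fin (n G) → Fin (n P)} {ρ : Fin (n P) → Fin (n G)} →
  (∀ a → ρ (φ a) ≡ a) → (∀ {e} → IsEdge G e → IsEdge P (image φ e)) →
  ∀ {K Y S w e} → IsEdge G e → S ∪ ⁅ w ⁆ ≡ image φ e →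
  (∀ u → u ∉ K → φ u ∉ Y) → ρ w ∉ K →
  Forces P Y S w → Forces G K (image ρ S) (ρ w)
forces-pullback {G} {P} {φ} {ρ} ρ∘φ φ-edge {K} {Y} {S} {w} {e} edge S∪w≡φe white ρw∉K
                (w∉S , _ , _ , unique) = ρw∉ρS , ρw∉K , edge′ , unique′
  where
  φ-injective : Injective _≡_ _≡_ φ
  φ-injective {a} {a′} eq = trans (sym (ρ∘φ a)) (trans (cong ρ eq) (ρ∘φ a′))

  φ∘ρ : ∀ {i} → i ∈ S ∪ ⁅ w ⁆ → φ (ρ i) ≡ i
  φ∘ρ i∈ with ∈-image⁻ φ e (subst (_ ∈_) S∪w≡φe i∈)
  ... | a , _ , refl = cong φ (ρ∘φ a)

  φ∘ρ-w : φ (ρ w) ≡ w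
  φ∘ρ-w = φ∘ρ (Sub.q⊆p∪q S _ (Sub.x∈⁅x⁆ w))

  φρS≡S : image φ (image ρ S) ≡ S
  φρS≡S = Sub.⊆-antisym ⊆S S⊆
    where
    ⊆S : image φ (image ρ S) ⊆ S
    ⊆S i∈ with ∈-image⁻ φ _ i∈
    ... | a , a∈ , refl with ∈-image⁻ ρ S a∈
    ...   | s , s∈ , refl = subst (_∈ S) (sym (φ∘ρ (Sub.p⊆p∪q _ s∈))) s∈
    S⊆ : S ⊆ image φ (image ρ S)
    S⊆ i∈ = subst (_∈ image φ (image ρ S)) (φ∘ρ (Sub.p⊆p∪q _ i∈)) (∈-image⁺ φ _ (∈-image⁺ ρ S i∈))

  φ-∪⁅⁆ : ∀ a → image φ (image ρ S ∪ ⁅ a ⁆) ≡ S ∪ ⁅ φ a ⁆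
  φ-∪⁅⁆ a = trans (image-∪⁅⁆ φ (image ρ S) a) (cong (_∪ ⁅ φ a ⁆) φρS≡S)

  ρw∉ρS : ρ w ∉ image ρ S
  ρw∉ρS ρw∈ with ∈-image⁻ ρ S ρw∈
  ... | s , s∈ , ρs≡ρw = w∉S (subst (_∈ S) s≡w s∈)
    where
    s≡w : s ≡ w
    s≡w = trans (sym (φ∘ρ (Sub.p⊆p∪q _ s∈))) (trans (cong φ ρs≡ρw) φ∘ρ-w)

  edge′ : IsEdge G (image ρ S ∪ ⁅ ρ w ⁆)
  edge′ = subst (IsEdge G) (sym (image-injective φ φ-injective φ-lifted)) edge
    where
    φ-lifted : image φ (image ρ S ∪ ⁅ ρ w ⁆) ≡ image φ e
    φ-lifted = trans (φ-∪⁅⁆ (ρ w)) (trans (cong (λ x → S ∪ ⁅ x ⁆) φ∘ρ-w) S∪w≡φe)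

  unique′ : ∀ u → u ∉ K → IsEdge G (image ρ S ∪ ⁅ u ⁆) → u ≡ ρ w
  unique′ u u∉K edge-u =
    trans (sym (ρ∘φ u))
      (cong ρ (unique (φ u) (white u u∉K) (subst (IsEdge P) (φ-∪⁅⁆ u) (φ-edge edge-u))))

RowEdge : (G : Hypergraph) {m N : ℕ} → (Fin (n G) → Fin m → Fin N) → Subset N → Set
RowEdge G {m} pair E = Σ[ e ∈ Subset (n G) ] Σ[ b ∈ Fin m ] IsEdge G e × E ≡ image (λ a → pair a b) e

-- P is abstractly the Cartesian product of G₁ and G₂, in a form invariant under swap.
record Product (G₁ G₂ P : Hypergraph) : Set where
  field
    pair         : Fin (n G₁) → Fin (n G₂) → Fin (n P)
    fst          : Fin (n P) → Fin (n G₁)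
    snd          : Fin (n P) → Fin (n G₂)
    fst-pair     : ∀ a b → fst (pair a b) ≡ a
    snd-pair     : ∀ a b → snd (pair a b) ≡ b
    pair-fst-snd : ∀ i → pair (fst i) (snd i) ≡ i
    row-edge     : ∀ b {e} → IsEdge G₁ e → IsEdge P (image (λ a → pair a b) e)
    col-edge     : ∀ a {e} → IsEdge G₂ e → IsEdge P (image (λ b → pair a b) e)
    edge-cases   : ∀ {E} → IsEdge P E → RowEdge G₁ pair E ⊎ RowEdge G₂ (flip pair) E

swap : ∀ {G₁ G₂ P} → Product G₁ G₂ P → Product G₂ G₁ P
swap Π = record
  { pair = flip pair ; fst = snd ; snd = fst
  ; fst-pair = flip snd-pair ; snd-pair = flip fst-pair ; pair-fst-snd = pair-fst-snd
  ; row-edge = col-edge ; col-edge = row-edge ; edge-cases = Sum.swap ∘ edge-cases }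
  where open Product Π

module Rows {G₁ G₂ P : Hypergraph} (Π : Product G₁ G₂ P) where
  open Product Π

  row : Fin (n G₂) → Subset (n G₁) → Subset (n P)
  row b e = image (λ a → pair a b) e

  pair-injectiveˡ : ∀ b → Injective _≡_ _≡_ (λ a → pair a b)
  pair-injectiveˡ b {a} {a′} eq = trans (sym (fst-pair a b)) (trans (cong fst eq) (fst-pair a′ b))

  ∣row∣ : ∀ b e → ∣ row b e ∣ ≡ ∣ e ∣
  ∣row∣ b = ∣image∣≡∣p∣ _ (pair-injectiveˡ b)

  snd-∈row : ∀ {b e i} → i ∈ row b e → snd i ≡ b
  snd-∈row {b} {e} i∈ with ∈-image⁻ _ e i∈
  ... | a , _ , refl = snd-pair a b

module RowForcing {G₁ G₂ P : Hypergraph} (Π : Product G₁ G₂ P) where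
  open Product Π
  open Rows Π
  open Rows (swap Π) using () renaming (row to col; snd-∈row to fst-∈col)

  edge-through-row : ∀ {b S u} → 2 ≤ ∣ S ∣ → IsEdge P (row b S ∪ ⁅ u ⁆) →
                     Σ[ a ∈ Fin (n G₁) ] u ≡ pair a b × IsEdge G₁ (S ∪ ⁅ a ⁆)
  edge-through-row {b} {S} {u} 2≤∣S∣ edge with edge-cases edge
  ... | inj₂ (e , a , _ , eq) = ⊥-elim (ℕ.<⇒≱ 2≤∣S∣ ∣S∣≤1)
    where
    S⊆⁅a⁆ : S ⊆ ⁅ a ⁆
    S⊆⁅a⁆ {s} s∈ = subst (_∈ ⁅ a ⁆) (sym s≡a) (Sub.x∈⁅x⁆ a)
      where
      s≡a : s ≡ a
      s≡a = trans (sym (fst-pair s b))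
                  (fst-∈col {a} {e} (subst (pair s b ∈_) eq (Sub.p⊆p∪q _ (∈-image⁺ _ S s∈))))
    ∣S∣≤1 : ∣ S ∣ ≤ 1
    ∣S∣≤1 = subst (∣ S ∣ ≤_) (Sub.∣⁅x⁆∣≡1 a) (Sub.p⊆q⇒∣p∣≤∣q∣ S⊆⁅a⁆)
  ... | inj₁ (e , b′ , edge-e , eq) with ∣p∣≥1⇒nonempty S (ℕ.≤-trans (s≤s z≤n) 2≤∣S∣)
  ...   | s , s∈ with trans (sym (snd-pair s b))
                            (snd-∈row {b′} {e} (subst (pair s b ∈_) eq (Sub.p⊆p∪q _ (∈-image⁺ _ S s∈))))
  ...     | refl with ∈-image⁻ _ e (subst (u ∈_) eq (Sub.q⊆p∪q (row b S) _ (Sub.x∈⁅x⁆ u)))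
  ...       | a , _ , refl = a , refl , subst (IsEdge G₁) (sym S∪a≡e) edge-e
    where
    S∪a≡e : S ∪ ⁅ a ⁆ ≡ e
    S∪a≡e = image-injective _ (pair-injectiveˡ b) (trans (image-∪⁅⁆ _ S a) eq)

  row-force : ∀ {d} → 3 ≤ d → ∀ X b {C D} → ForceStep d G₁ C D →
              Star (ForceStep d P) (X ∪ row b C) (X ∪ row b D)
  row-force {d} d≥3 X b (force {C} S w ∣S∣+1≡d w∉C edge unique) with pair w b Sub.∈? (X ∪ row b C)
  ... | yes blue = subst (Star _ (X ∪ row b C)) already-blue ε
    where
    already-blue : X ∪ row b C ≡ X ∪ row b (C ∪ ⁅ w ⁆)
    already-blue = sym (trans (cong (X ∪_) (image-∪⁅⁆ _ C w))
                              (trans (sym (Sub.∪-assoc X _ _)) (∪⁅⁆-absorb _ blue)))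
  ... | no white = subst (Star _ (X ∪ row b C)) newly-blue
                     (force (row b S) (pair w b) ∣rowS∣+1≡d white edge′ unique′ ◅ ε)
    where
    newly-blue : (X ∪ row b C) ∪ ⁅ pair w b ⁆ ≡ X ∪ row b (C ∪ ⁅ w ⁆)
    newly-blue = trans (Sub.∪-assoc X _ _) (cong (X ∪_) (sym (image-∪⁅⁆ _ C w)))
    ∣rowS∣+1≡d : ∣ row b S ∣ + 1 ≡ d
    ∣rowS∣+1≡d = trans (cong (_+ 1) (∣row∣ b S)) ∣S∣+1≡d
    edge′ : IsEdge P (row b S ∪ ⁅ pair w b ⁆)
    edge′ = subst (IsEdge P) (image-∪⁅⁆ _ S w) (row-edge b edge)
    2≤∣S∣ : 2 ≤ ∣ S ∣
    2≤∣S∣ = ℕ.+-cancelʳ-≤ 1 2 ∣ S ∣ (ℕ.≤-trans d≥3 (ℕ.≤-reflexive (sym ∣S∣+1≡d)))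
    unique′ : ∀ u → u ∉ X ∪ row b C → IsEdge P (row b S ∪ ⁅ u ⁆) → u ≡ pair w b
    unique′ u u∉ edge-u with edge-through-row {b} 2≤∣S∣ edge-u
    ... | a , refl , edge-a =
      cong (λ x → pair x b) (unique a (λ a∈C → u∉ (Sub.q⊆p∪q X _ (∈-image⁺ _ C a∈C))) edge-a)

  row-forcing : ∀ {d} → 3 ≤ d → ∀ X b {C D} → Star (ForceStep d G₁) C D →
                Star (ForceStep d P) (X ∪ row b C) (X ∪ row b D)
  row-forcing d≥3 X b = kleisliStar (λ C → X ∪ row b C) (row-force d≥3 X b)

  cylinder : Subset (n G₁) → Subset (n G₂) → Subset (n P)
  cylinder R C = preimage fst R ∪ preimage snd C

  row-force-impossible : ∀ {R C S w} → Closed G₁ R → Forces P (cylinder R C) S w →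
                         ¬ RowEdge G₁ pair (S ∪ ⁅ w ⁆)
  row-force-impossible {R} {C} {S} {w} closed forces@(_ , w∉cyl , _) (e , b , edge , eq) =
    closed (image fst S) (fst w)
      (forces-pullback (λ a → fst-pair a b) (row-edge b) edge eq row-white fst-w∉R forces)
    where
    snd-w : snd w ≡ b
    snd-w = snd-∈row {b} {e} (subst (w ∈_) eq (Sub.q⊆p∪q S _ (Sub.x∈⁅x⁆ w)))
    fst-w∉R : fst w ∉ R
    fst-w∉R = w∉cyl ∘ Sub.p⊆p∪q (preimage snd C) ∘ ∈-preimage⁺ fst R
    row-white : ∀ u → u ∉ R → pair u b ∉ cylinder R C
    row-white u u∉R ub∈ with Sub.x∈p∪q⁻ (preimage fst R) (preimage snd C) ub∈
    ... | inj₁ ub∈R = u∉R (subst (_∈ R) (fst-pair u b) (∈-preimage⁻ fst R ub∈R))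
    ... | inj₂ ub∈C = w∉cyl (Sub.q⊆p∪q (preimage fst R) _ (∈-preimage⁺ snd C
            (subst (_∈ C) (trans (snd-pair u b) (sym snd-w)) (∈-preimage⁻ snd C ub∈C))))

module ProductZeroForcing {G₁ G₂ P : Hypergraph} (Π : Product G₁ G₂ P) where
  open Product Π
  open Rows Π
  open Rows (swap Π) using () renaming (row to col; ∣row∣ to ∣col∣)
  open RowForcing Π
  open RowForcing (swap Π) using ()
    renaming (row-forcing to col-forcing; row-force-impossible to col-force-impossible)

  uniform : ∀ {d} → Uniform d G₁ → Uniform d G₂ → Uniform d P
  uniform {d} G₁-uniform G₂-uniform = All.tabulate ∣E∣≡d
    where
    ∣E∣≡d : ∀ {E} → IsEdge P E → ∣ E ∣ ≡ d
    ∣E∣≡d E∈ with edge-cases E∈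
    ... | inj₁ (e , b , edge , refl) = trans (∣row∣ b e) (∣edge∣≡d G₁-uniform edge)
    ... | inj₂ (e , a , edge , refl) = trans (∣col∣ a e) (∣edge∣≡d G₂-uniform edge)

  _⊠_ : Subset (n G₁) → Subset (n G₂) → Subset (n P)
  A ⊠ B = ⋃[ A ] (λ a → col a B)

  ∣⊠∣≤ : ∀ A B → ∣ A ⊠ B ∣ ≤ ∣ A ∣ * ∣ B ∣
  ∣⊠∣≤ A B = ∣⋃∣≤ A _ (λ a → ∣image∣≤∣p∣ _ B)

  ⊠-by-rows : ∀ A B → A ⊠ B ≡ ⋃[ B ] (λ b → row b A)
  ⊠-by-rows A B = Sub.⊆-antisym ⊆rows rows⊆
    where
    ⊆rows : A ⊠ B ⊆ ⋃[ B ] (λ b → row b A)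
    ⊆rows i∈ with ∈-⋃⁻ A _ i∈
    ... | a , a∈ , i∈col with ∈-image⁻ _ B i∈col
    ...   | b , b∈ , refl = ∈-⋃⁺ B _ b∈ (∈-image⁺ _ A a∈)
    rows⊆ : ⋃[ B ] (λ b → row b A) ⊆ A ⊠ B
    rows⊆ i∈ with ∈-⋃⁻ B _ i∈
    ... | b , b∈ , i∈row with ∈-image⁻ _ A i∈row
    ...   | a , a∈ , refl = ∈-⋃⁺ A _ a∈ (∈-image⁺ _ B b∈)

  ⊤⊠⊤ : ⊤ ⊠ ⊤ ≡ ⊤
  ⊤⊠⊤ = Sub.⊆-antisym Sub.⊆⊤ λ {i} _ →
    subst (_∈ ⊤ ⊠ ⊤) (pair-fst-snd i)
      (∈-⋃⁺ ⊤ (λ a → col a ⊤) Sub.∈⊤ (∈-image⁺ (pair (fst i)) ⊤ Sub.∈⊤))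

  ⊠-zeroForcing : ∀ {d A B} → 3 ≤ d → ZeroForcingSet d G₁ A → ZeroForcingSet d G₂ B →
                  ZeroForcingSet d P (A ⊠ B)
  ⊠-zeroForcing {d} {A} {B} d≥3 A-forces B-forces = begin
    A ⊠ B                           ≡⟨ Sub.∪-identityˡ (A ⊠ B) ⟨
    ⊥ ∪ ⋃[ A ] (λ a → col a B)      ⟶*⟨ Star-⋃ (λ a Y → col-forcing d≥3 Y a B-forces) A ⊥ ⟩
    ⊥ ∪ ⋃[ A ] (λ a → col a ⊤)      ≡⟨ cong (⊥ ∪_) (⊠-by-rows A ⊤) ⟩
    ⊥ ∪ ⋃[ ⊤ ] (λ b → row b A)      ⟶*⟨ Star-⋃ (λ b Y → row-forcing d≥3 Y b A-forces) ⊤ ⊥ ⟩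
    ⊥ ∪ ⋃[ ⊤ ] (λ b → row b ⊤)      ≡⟨ cong (⊥ ∪_) (⊠-by-rows ⊤ ⊤) ⟨
    ⊥ ∪ (⊤ ⊠ ⊤)                     ≡⟨ trans (Sub.∪-identityˡ (⊤ ⊠ ⊤)) ⊤⊠⊤ ⟩
    ⊤                               ∎
    where open StarReasoning (ForceStep d P)

  closed-cylinder : ∀ {R C} → Closed G₁ R → Closed G₂ C → Closed P (cylinder R C)
  closed-cylinder {R} {C} R-closed C-closed S w forces@(_ , _ , edge , _) with edge-cases edge
  ... | inj₁ row-edge = row-force-impossible {C = C} R-closed forces row-edge
  ... | inj₂ col-edge = col-force-impossible {C = R} C-closed
          (subst (λ K → Forces P K S w) (Sub.∪-comm (preimage fst R) (preimage snd C)) forces)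
          col-edge

  snd-image-zeroForcing : ∀ {d B} → Uniform d G₁ → Uniform d G₂ → ¬ ZeroForcingSet d G₁ ⊥ →
                          ZeroForcingSet d P B → ZeroForcingSet d G₂ (image snd B)
  snd-image-zeroForcing {B = B} G₁-uniform G₂-uniform ∅-fails B-forces
    with zeroForcing⊎stalls G₂-uniform (image snd B)
  ... | inj₁ sndB-forces = sndB-forces
  ... | inj₂ (C , sndB⊆C , C-closed , v , v∉C) with zeroForcing⊎stalls G₁-uniform ⊥
  ...   | inj₁ ∅-forces = ⊥-elim (∅-fails ∅-forces)
  ...   | inj₂ (R , _ , R-closed , x , x∉R) = ⊥-elim (xv∉cyl (⊤⊆cyl Sub.∈⊤))
    where
    B⊆cyl : B ⊆ cylinder R C
    B⊆cyl i∈ = Sub.q⊆p∪q (preimage fst R) _ (∈-preimage⁺ snd C (sndB⊆C (∈-image⁺ snd B i∈)))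
    ⊤⊆cyl : ⊤ ⊆ cylinder R C
    ⊤⊆cyl = closed-confines (uniform G₁-uniform G₂-uniform)
              (closed-cylinder R-closed C-closed) B⊆cyl B-forces
    xv∉cyl : pair x v ∉ cylinder R C
    xv∉cyl xv∈ with Sub.x∈p∪q⁻ (preimage fst R) (preimage snd C) xv∈
    ... | inj₁ ∈R = x∉R (subst (_∈ R) (fst-pair x v) (∈-preimage⁻ fst R ∈R))
    ... | inj₂ ∈C = v∉C (subst (_∈ C) (snd-pair x v) (∈-preimage⁻ snd C ∈C))

  Z₀-≤-zeroForcing : ∀ {d k k′ B} → Uniform d G₁ → Uniform d G₂ → IsZ0 d G₁ k → 1 ≤ k →
                     IsZ0 d G₂ k′ → ZeroForcingSet d P B → k′ ≤ ∣ B ∣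
  Z₀-≤-zeroForcing {d} {k} {B = B} G₁-uniform G₂-uniform
                   (_ , k-minimal) 1≤k (_ , k′-minimal) B-forces =
    ℕ.≤-trans (k′-minimal _ (snd-image-zeroForcing G₁-uniform G₂-uniform ∅-fails B-forces))
              (∣image∣≤∣p∣ snd B)
    where
    ∅-fails : ¬ ZeroForcingSet d G₁ ⊥
    ∅-fails ∅-forces = ℕ.<⇒≱ 1≤k (subst (k ≤_) (Sub.∣⊥∣≡0 (n G₁)) (k-minimal ⊥ ∅-forces))

module _ {A B C : Set} (g : A → B → C) where

  ∈-concatMap-map⁺ : ∀ {xs ys x y} → x ∈ₗ xs → y ∈ₗ ys → g x y ∈ₗ concatMap (λ x → map (g x) ys) xs
  ∈-concatMap-map⁺ x∈ y∈ = ∈-concat⁺′ (∈-map⁺ (g _) y∈) (∈-map⁺ (λ x → map (g x) _) x∈)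

  ∈-concatMap-map⁻ : ∀ xs ys {z} → z ∈ₗ concatMap (λ x → map (g x) ys) xs →
                     Σ[ x ∈ A ] Σ[ y ∈ B ] x ∈ₗ xs × z ≡ g x y
  ∈-concatMap-map⁻ xs ys z∈ with ∈-concat⁻′ (map (λ x → map (g x) ys) xs) z∈
  ... | zs , z∈zs , zs∈ with ∈-map⁻ (λ x → map (g x) ys) zs∈
  ...   | x , x∈ , refl with ∈-map⁻ (g x) z∈zs
  ...     | y , _ , refl = x , y , x∈ , refl

□-product : (H H′ : Hypergraph) → Product H H′ (H □ H′)
□-product H H′ = record
  { pair = combine ; fst = fst ; snd = snd
  ; fst-pair = λ a b → cong proj₁ (Fin.remQuot-combine a b)
  ; snd-pair = λ a b → cong proj₂ (Fin.remQuot-combine a b)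
  ; pair-fst-snd = Fin.combine-remQuot {n H} (n H′)
  ; row-edge = row-edge ; col-edge = col-edge ; edge-cases = edge-cases }
  where
  fst : Fin (n H * n H′) → Fin (n H)
  fst = proj₁ ∘ remQuot {n H} (n H′)
  snd : Fin (n H * n H′) → Fin (n H′)
  snd = proj₂ ∘ remQuot {n H} (n H′)

  ⌊≟⌋⇒≡ : ∀ {m} {x y : Fin m} → ⌊ x Fin.≟ y ⌋ ≡ true → x ≡ y
  ⌊≟⌋⇒≡ eq = toWitness (Equivalence.from Bool.T-≡ eq)

  ⌊≟⌋-refl : ∀ {m} (x : Fin m) → ⌊ x Fin.≟ x ⌋ ≡ true
  ⌊≟⌋-refl x = Equivalence.to Bool.T-≡ (fromWitness refl)

  grid : (Fin (n H) → Bool) → (Fin (n H′) → Bool) → Subset (n H * n H′)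
  grid g h = tabulate (λ i → g (fst i) ∧ h (snd i))

  ∈-grid⁺ : ∀ g h {a b} → g a ≡ true → h b ≡ true → combine a b ∈ grid g h
  ∈-grid⁺ g h {a} {b} ga hb = ∈-tabulate⁺ (cong₂ _∧_
    (trans (cong (g ∘ proj₁) (Fin.remQuot-combine a b)) ga)
    (trans (cong (h ∘ proj₂) (Fin.remQuot-combine a b)) hb))

  ∈-grid⁻ : ∀ g h {i} → i ∈ grid g h → g (fst i) ≡ true × h (snd i) ≡ true
  ∈-grid⁻ g h {i} i∈ = Bool.∧-conicalˡ _ _ gh , Bool.∧-conicalʳ _ _ gh
    where
    gh : g (fst i) ∧ h (snd i) ≡ true
    gh = ∈-tabulate⁻ i∈

  liftL≡row : ∀ e b → liftL {n H} {n H′} e b ≡ image (λ a → combine a b) e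
  liftL≡row e b = Sub.⊆-antisym ⊆row row⊆
    where
    ⊆row : liftL {n H} {n H′} e b ⊆ image (λ a → combine a b) e
    ⊆row {i} i∈ with ∈-grid⁻ (lookup e) (λ y → ⌊ y Fin.≟ b ⌋) i∈
    ... | fst-i∈e , snd-i≡b =
      subst (_∈ image (λ a → combine a b) e)
        (trans (cong (combine (fst i)) (sym (⌊≟⌋⇒≡ snd-i≡b))) (Fin.combine-remQuot {n H} (n H′) i))
        (∈-image⁺ _ e (Vec.lookup⇒[]= _ e fst-i∈e))
    row⊆ : image (λ a → combine a b) e ⊆ liftL {n H} {n H′} e b
    row⊆ i∈ with ∈-image⁻ _ e i∈
    ... | a , a∈ , refl = ∈-grid⁺ (lookup e) (λ y → ⌊ y Fin.≟ b ⌋) (Vec.[]=⇒lookup a∈) (⌊≟⌋-refl b)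

  liftR≡col : ∀ a e → liftR {n H} {n H′} a e ≡ image (combine a) e
  liftR≡col a e = Sub.⊆-antisym ⊆col col⊆
    where
    ⊆col : liftR {n H} {n H′} a e ⊆ image (combine a) e
    ⊆col {i} i∈ with ∈-grid⁻ (λ x → ⌊ x Fin.≟ a ⌋) (lookup e) i∈
    ... | fst-i≡a , snd-i∈e =
      subst (_∈ image (combine a) e)
        (trans (cong (λ x → combine x (snd i)) (sym (⌊≟⌋⇒≡ fst-i≡a)))
               (Fin.combine-remQuot {n H} (n H′) i))
        (∈-image⁺ _ e (Vec.lookup⇒[]= _ e snd-i∈e))
    col⊆ : image (combine a) e ⊆ liftR {n H} {n H′} a e
    col⊆ i∈ with ∈-image⁻ _ e i∈
    ... | b , b∈ , refl = ∈-grid⁺ (λ x → ⌊ x Fin.≟ a ⌋) (lookup e) (⌊≟⌋-refl a) (Vec.[]=⇒lookup b∈)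

  rows : List (Subset (n H * n H′))
  rows = concatMap (λ e → map (liftL e) (allFin (n H′))) (edges H)

  row-edge : ∀ b {e} → IsEdge H e → IsEdge (H □ H′) (image (λ a → combine a b) e)
  row-edge b {e} e∈ = subst (IsEdge (H □ H′)) (liftL≡row e b)
    (∈-++⁺ˡ (∈-concatMap-map⁺ liftL e∈ (∈-allFin b)))

  col-edge : ∀ a {e} → IsEdge H′ e → IsEdge (H □ H′) (image (λ b → combine a b) e)
  col-edge a {e} e∈ = subst (IsEdge (H □ H′)) (liftR≡col a e)
    (∈-++⁺ʳ rows (∈-concatMap-map⁺ (flip liftR) e∈ (∈-allFin a)))

  edge-cases : ∀ {E} → IsEdge (H □ H′) E → RowEdge H combine E ⊎ RowEdge H′ (flip combine) E
  edge-cases E∈ with ∈-++⁻ rows E∈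
  ... | inj₁ E∈rows with ∈-concatMap-map⁻ liftL (edges H) (allFin (n H′)) E∈rows
  ...   | e , b , e∈ , refl = inj₁ (e , b , e∈ , liftL≡row e b)
  edge-cases E∈ | inj₂ E∈cols with ∈-concatMap-map⁻ (flip liftR) (edges H′) (allFin (n H)) E∈cols
  ...   | e , a , e∈ , refl = inj₂ (e , a , e∈ , liftR≡col a e)

*≤-from-factor-bounds : ∀ k k′ {b} → k * k′ ≤ 3 → (1 ≤ k → k′ ≤ b) → (1 ≤ k′ → k ≤ b) → k * k′ ≤ b
*≤-from-factor-bounds zero k′ _ _ _ = z≤n
*≤-from-factor-bounds (suc k) zero _ _ _ rewrite ℕ.*-zeroʳ k = z≤n
*≤-from-factor-bounds 1 (suc k′) _ k′≤b _ rewrite ℕ.+-identityʳ k′ = k′≤b (s≤s z≤n)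
*≤-from-factor-bounds (suc (suc k)) 1 _ _ k≤b rewrite ℕ.*-identityʳ k = k≤b (s≤s z≤n)
*≤-from-factor-bounds (suc (suc k)) (suc (suc k′)) kk′≤3 _ _ =
  ⊥-elim (ℕ.<⇒≱ (s≤s (s≤s (s≤s (s≤s z≤n)))) (ℕ.≤-trans 4≤kk′ kk′≤3))
  where
  4≤kk′ : 4 ≤ suc (suc k) * suc (suc k′)
  4≤kk′ = ℕ.*-mono-≤ {2} {suc (suc k)} {2} {suc (suc k′)} (s≤s (s≤s z≤n)) (s≤s (s≤s z≤n))

corollary3p24 : (d : ℕ) → 3 ≤ d → (H H' : Hypergraph) → Uniform d H → Uniform d H' →
    (k k' : ℕ) → IsZ0 d H k → IsZ0 d H' k' → k * k' ≤ 3 →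
    IsZ0 d (H □ H') (k * k')
corollary3p24 d d≥3 H H' H-uniform H'-uniform k k' Z₀H@((B , B-forces , ∣B∣≡k) , _)
                                                   Z₀H'@((B' , B'-forces , ∣B'∣≡k') , _) kk'≤3 =
  (B ⊠ B' , B⊠B'-forces , ℕ.≤-antisym ∣B⊠B'∣≤kk' (lower-bound (B ⊠ B') B⊠B'-forces)) , lower-bound
  where
  Π : Product H H' (H □ H')
  Π = □-product H H'
  open ProductZeroForcing Π
  open ProductZeroForcing (swap Π) using () renaming (Z₀-≤-zeroForcing to Z₀-≤-zeroForcing′)
  B⊠B'-forces : ZeroForcingSet d (H □ H') (B ⊠ B')
  B⊠B'-forces = ⊠-zeroForcing d≥3 B-forces B'-forces
  ∣B⊠B'∣≤kk' : ∣ B ⊠ B' ∣ ≤ k * k'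
  ∣B⊠B'∣≤kk' = subst (∣ B ⊠ B' ∣ ≤_) (cong₂ _*_ ∣B∣≡k ∣B'∣≡k') (∣⊠∣≤ B B')
  lower-bound : ∀ X → ZeroForcingSet d (H □ H') X → k * k' ≤ ∣ X ∣
  lower-bound X X-forces = *≤-from-factor-bounds k k' kk'≤3
    (λ 1≤k → Z₀-≤-zeroForcing H-uniform H'-uniform Z₀H 1≤k Z₀H' X-forces)
    (λ 1≤k' → Z₀-≤-zeroForcing′ H'-uniform H-uniform Z₀H' 1≤k' Z₀H X-forces)
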